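{- Let $G=(V,E)$ be any finite graph and suppose $v\in V$ satisfies: (i) $d_v\geq 2$, and (ii) for each neighbor $u$ of $v$, $d_u\leq d_v-2$. Then $\kappa(v)\leq 0$.
   Context: $d_w$ denotes the degree of vertex $w$. For a finite graph with Laplacian $\mathbf{L}=\mathbf{D}-\mathbf{A}$ (degree matrix minus adjacency matrix) and Moore--Penrose pseudoinverse $\mathbf{L}^\dagger$, the effective resistance between $u,v$ is $r_{uv}=(\mathbf{1}_u-\mathbf{1}_v)^\top\mathbf{L}^\dagger(\mathbf{1}_u-\mathbf{1}_v)$, and the resistance curvature at $v$ is $\kappa(v)=1-\frac12\sum_{u\sim v} r_{uv}$, summing over neighbors $u$ of $v$. -}

module Defs where

open import Data.Nat as ℕ using (ℕ; zero; suc)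
open import Data.Bool using (Bool; true; false; if_then_else_)
open import Data.Fin using (Fin; zero; suc; _≟_)
open import Relation.Nullary.Decidable using (⌊_⌋)
open import Data.Integer using (+_)
open import Data.Rational using (ℚ; 0ℚ; 1ℚ; ½; _+_; _*_; _-_; -_; _/_)
open import Relation.Binary.PropositionalEquality using (_≡_)

record Graph (n : ℕ) : Set where
  field
    adj   : Fin n → Fin n → Bool
    sym   : ∀ i j → adj i j ≡ adj j i
    irrefl : ∀ i → adj i i ≡ false
open Graph public

Σℚ : (n : ℕ) → (Fin n → ℚ) → ℚ
Σℚ zero    f = 0ℚ
Σℚ (suc n) f = f zero + Σℚ n (λ i → f (suc i))

countℕ : (n : ℕ) → (Fin n → Bool) → ℕ
countℕ zero    f = 0
countℕ (suc n) f = (if f zero then 1 else 0) ℕ.+ countℕ n (λ i → f (suc i))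

deg : ∀ {n} → Graph n → Fin n → ℕ
deg {n} G w = countℕ n (adj G w)

ℕtoℚ : ℕ → ℚ
ℕtoℚ k = (+ k) / 1

Matrix : ℕ → Set
Matrix n = Fin n → Fin n → ℚ

adjMatrix : ∀ {n} → Graph n → Matrix n
adjMatrix G i j = if adj G i j then 1ℚ else 0ℚ

degMatrix : ∀ {n} → Graph n → Matrix n
degMatrix G i j = if ⌊ i ≟ j ⌋ then ℕtoℚ (deg G i) else 0ℚ

laplacian : ∀ {n} → Graph n → Matrix n
laplacian G i j = degMatrix G i j - adjMatrix G i j

_⊗_ : ∀ {n} → Matrix n → Matrix n → Matrix n
_⊗_ {n} M N i j = Σℚ n (λ k → M i k * N k j)

transpose : ∀ {n} → Matrix n → Matrix n
transpose M i j = M j i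

record IsPseudoinverse {n : ℕ} (M X : Matrix n) : Set where
  field
    p1 : ∀ i j → ((M ⊗ X) ⊗ M) i j ≡ M i j
    p2 : ∀ i j → ((X ⊗ M) ⊗ X) i j ≡ X i j
    p3 : ∀ i j → transpose (M ⊗ X) i j ≡ (M ⊗ X) i j
    p4 : ∀ i j → transpose (X ⊗ M) i j ≡ (X ⊗ M) i j

indicator : ∀ {n} → Fin n → Fin n → ℚ
indicator u i = if ⌊ u ≟ i ⌋ then 1ℚ else 0ℚ

quadForm : ∀ {n} → Matrix n → (Fin n → ℚ) → ℚ
quadForm {n} M x = Σℚ n (λ i → Σℚ n (λ j → x i * M i j * x j))

-- effective resistance r_uv computed from a pseudoinverse X of L
resistance : ∀ {n} → Matrix n → Fin n → Fin n → ℚ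
resistance X u v = quadForm X (λ i → indicator u i - indicator v i)

curvature : ∀ {n} → Graph n → Matrix n → Fin n → ℚ
curvature {n} G X v =
  1ℚ - ½ * Σℚ n (λ u → if adj G v u then resistance X u v else 0ℚ)

{-# OPTIONS --safe #-}
module Submission where

-- For an edge uv put b = 1_u - 1_v and y = L†b. The Penrose equations give
-- y·Ly = b·L†b = r_uv, and Ly = b - e with e in the kernel of L; since e is
-- constant along the edge uv, b·Ly = 2, while b·Lb = d_u + d_v + 2.
-- Positive semidefiniteness of L at y - t b gives 4t - t²(d_u + d_v + 2) ≤ r_uv
-- for every t, which at t = 1/d_v and d_u + 2 ≤ d_v reads r_uv ≥ 2/d_v.
-- Summing over the d_v neighbours of v gives ∑ r_uv ≥ 2, that is κ(v) ≤ 0.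

open import Defs hiding (sym)

open import Algebra.Bundles using (CommutativeRing)
open import Algebra.Properties.Semiring.Sum as Sum using ()
open import Data.Bool using (Bool; true; false; if_then_else_)
open import Data.Empty using (⊥-elim)
open import Data.Fin using (Fin; zero; suc; _≟_; punchIn)
import Data.Integer as ℤ
import Data.Integer.Properties as ℤ
open import Data.Nat as ℕ using (ℕ; zero; suc)
import Data.Nat.Properties as ℕ
open import Data.Nat.Coprimality as Coprimality using (1-coprimeTo)
open import Data.Product using (_,_)
open import Data.Rational
  using (ℚ; mkℚ; 0ℚ; 1ℚ; ½; _+_; _*_; _-_; -_; _/_; 1/_; _≤_; _<_; NonZero; nonNegative; nonPositive; positive; negative)
open import Data.Rational.Properties as ℚ
  using (+-*-commutativeRing; ≤-refl; +-mono-≤; +-monoʳ-≤; neg-antimono-≤)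
open import Algebra.Properties.Ring ℚ.+-*-ring using (-‿involutive; x[y-z]≈xy-xz; [y-z]x≈yx-zx)
open import Data.Sum using (inj₁; inj₂)
open import Function using (_∘_)
open import Level using (0ℓ)
open import Relation.Binary using (tri<; tri≈; tri>)
open import Relation.Binary.PropositionalEquality
open import Relation.Nullary using (Dec; yes; no)
open import Relation.Nullary.Decidable using (⌊_⌋; isYes≗does; dec-true; dec-false; dec⇒maybe)
open import Tactic.RingSolver using (solve-∀)
open import Tactic.RingSolver.Core.AlmostCommutativeRing using (AlmostCommutativeRing; fromCommutativeRing)

open Sum (CommutativeRing.semiring +-*-commutativeRing)
  using (sum; sum-syntax; sum-cong-≗; sum-replicate-zero; sum-remove; ∑-distrib-+; ∑-comm; *-distribˡ-sum; *-distribʳ-sum)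

ℚ-ring : AlmostCommutativeRing 0ℓ 0ℓ
ℚ-ring = fromCommutativeRing +-*-commutativeRing (dec⇒maybe ∘ (0ℚ ℚ.≟_))

2ℚ : ℚ
2ℚ = 1ℚ + 1ℚ

ℕtoℚ≡mkℚ : ∀ k → ℕtoℚ k ≡ mkℚ (ℤ.+ k) 0 (Coprimality.sym (1-coprimeTo k))
ℕtoℚ≡mkℚ k = ℚ.normalize-coprime (Coprimality.sym (1-coprimeTo k))

ℕtoℚ-+ : ∀ m n → ℕtoℚ (m ℕ.+ n) ≡ ℕtoℚ m + ℕtoℚ n
ℕtoℚ-+ m n rewrite ℕtoℚ≡mkℚ m | ℕtoℚ≡mkℚ n =
  cong (_/ 1) (trans (ℤ.pos-+ m n) (sym (cong₂ ℤ._+_ (ℤ.*-identityʳ (ℤ.+ m)) (ℤ.*-identityʳ (ℤ.+ n)))))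

ℕtoℚ-nonNeg : ∀ k → 0ℚ ≤ ℕtoℚ k
ℕtoℚ-nonNeg k = ℚ.nonNegative⁻¹ (ℕtoℚ k) {{ℚ.normalize-nonNeg k 1}}

ℕtoℚ-mono-≤ : ∀ {m n} → m ℕ.≤ n → ℕtoℚ m ≤ ℕtoℚ n
ℕtoℚ-mono-≤ {m} m≤n with ℕ.m≤n⇒∃[o]m+o≡n m≤n
... | o , refl = begin
  ℕtoℚ m           ≡⟨ ℚ.+-identityʳ (ℕtoℚ m) ⟨
  ℕtoℚ m + 0ℚ      ≤⟨ +-monoʳ-≤ (ℕtoℚ m) (ℕtoℚ-nonNeg o) ⟩
  ℕtoℚ m + ℕtoℚ o  ≡⟨ ℕtoℚ-+ m o ⟨
  ℕtoℚ (m ℕ.+ o)   ∎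
  where open ℚ.≤-Reasoning

ℕtoℚ-nonZero : ∀ k → .{{ℕ.NonZero k}} → NonZero (ℕtoℚ k)
ℕtoℚ-nonZero k = ℚ.pos⇒nonZero (ℕtoℚ k) {{ℚ.normalize-pos k 1}}

0≤q-p⇒p≤q : ∀ {p q} → 0ℚ ≤ q - p → p ≤ q
0≤q-p⇒p≤q {p} {q} 0≤q-p = begin
  p            ≡⟨ ℚ.+-identityʳ p ⟨
  p + 0ℚ       ≤⟨ +-monoʳ-≤ p 0≤q-p ⟩
  p + (q - p)  ≡⟨ cancel p q ⟩
  q            ∎
  where
  open ℚ.≤-Reasoning
  cancel : ∀ p q → p + (q - p) ≡ q
  cancel = solve-∀ ℚ-ring

0≤p+p⇒0≤p : ∀ {p} → 0ℚ ≤ p + p → 0ℚ ≤ p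
0≤p+p⇒0≤p {p} 0≤p+p = subst (0ℚ ≤_) half-double (ℚ.*-monoˡ-≤-nonNeg ½ 0≤p+p)
  where
  half-double : ½ * (p + p) ≡ p
  half-double = trans (ℚ.*-distribˡ-+ ½ p p) (trans (sym (ℚ.*-distribʳ-+ p ½ ½)) (ℚ.*-identityˡ p))

p-q≡0⇒p≡q : ∀ {p q} → p - q ≡ 0ℚ → p ≡ q
p-q≡0⇒p≡q {p} {q} p-q≡0 = trans (regroup p q) (trans (cong (_+ q) p-q≡0) (ℚ.+-identityˡ q))
  where
  regroup : ∀ p q → p ≡ (p - q) + q
  regroup = solve-∀ ℚ-ring

*-nonNeg : ∀ {p q} → 0ℚ ≤ p → 0ℚ ≤ q → 0ℚ ≤ p * q
*-nonNeg {p} {q} 0≤p 0≤q = ℚ.nonNegative⁻¹ _ {{ℚ.nonNeg*nonNeg⇒nonNeg p {{nonNegative 0≤p}} q {{nonNegative 0≤q}}}}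

square-nonNeg : ∀ p → 0ℚ ≤ p * p
square-nonNeg p with ℚ.≤-total 0ℚ p
... | inj₁ 0≤p = *-nonNeg 0≤p 0≤p
... | inj₂ p≤0 = ℚ.nonNegative⁻¹ _ {{ℚ.nonPos*nonPos⇒nonPos p {{nonPositive p≤0}} p {{nonPositive p≤0}}}}

square≤0⇒≡0 : ∀ p → p * p ≤ 0ℚ → p ≡ 0ℚ
square≤0⇒≡0 p p²≤0 with ℚ.<-cmp p 0ℚ
... | tri≈ _ p≡0 _ = p≡0
... | tri< p<0 _ _ = ⊥-elim (ℚ.<-irrefl refl (ℚ.<-≤-trans 0<p² p²≤0))
  where
  0<p² : 0ℚ < p * p
  0<p² = ℚ.positive⁻¹ (p * p) {{ℚ.neg*neg⇒pos p {{negative p<0}} p {{negative p<0}}}}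
... | tri> _ _ p>0 = ⊥-elim (ℚ.<-irrefl refl (ℚ.<-≤-trans 0<p² p²≤0))
  where
  0<p² : 0ℚ < p * p
  0<p² = ℚ.positive⁻¹ (p * p) {{ℚ.pos*pos⇒pos p {{positive p>0}} p {{positive p>0}}}}

4t-t²q≤r⇒2t≤r : ∀ t d {q r} → t * d ≡ 1ℚ → q ≤ d + d → t * 2ℚ + t * 2ℚ - t * t * q ≤ r → t + t ≤ r
4t-t²q≤r⇒2t≤r t d {q} {r} td≡1 q≤2d 4t-t²q≤r = begin
  t + t                                  ≡⟨ ℚ.+-identityʳ (t + t) ⟨
  t + t + 0ℚ                             ≡⟨ cong (t + t +_) (trans (cong (λ w → (t + t) * (1ℚ - w)) td≡1) (ℚ.*-zeroʳ (t + t))) ⟨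
  t + t + (t + t) * (1ℚ - t * d)         ≡⟨ expand t d ⟩
  t * 2ℚ + t * 2ℚ - t * t * (d + d)      ≤⟨ +-monoʳ-≤ (t * 2ℚ + t * 2ℚ) (neg-antimono-≤ t²q≤t²[d+d]) ⟩
  t * 2ℚ + t * 2ℚ - t * t * q            ≤⟨ 4t-t²q≤r ⟩
  r                                      ∎
  where
  open ℚ.≤-Reasoning
  expand : ∀ t d → t + t + (t + t) * (1ℚ - t * d) ≡ t * (1ℚ + 1ℚ) + t * (1ℚ + 1ℚ) - t * t * (d + d)
  expand = solve-∀ ℚ-ring
  t²q≤t²[d+d] : t * t * q ≤ t * t * (d + d)
  t²q≤t²[d+d] = ℚ.*-monoˡ-≤-nonNeg (t * t) {{nonNegative (square-nonNeg t)}} q≤2d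

Σℚ≡sum : ∀ n (f : Fin n → ℚ) → Σℚ n f ≡ sum f
Σℚ≡sum zero    f = refl
Σℚ≡sum (suc n) f = cong (f zero +_) (Σℚ≡sum n (f ∘ suc))

∑-neg : ∀ {n} (f : Fin n → ℚ) → ∑[ i < n ] (- f i) ≡ - sum f
∑-neg {zero}  f = refl
∑-neg {suc n} f = trans (cong (- f zero +_) (∑-neg (f ∘ suc))) (sym (ℚ.neg-distrib-+ (f zero) (sum (f ∘ suc))))

∑-distrib-- : ∀ {n} (f g : Fin n → ℚ) → ∑[ i < n ] (f i - g i) ≡ sum f - sum g
∑-distrib-- f g = trans (∑-distrib-+ f (λ i → - g i)) (cong (sum f +_) (∑-neg g))

∑-zero : ∀ {n} (f : Fin n → ℚ) → (∀ i → f i ≡ 0ℚ) → sum f ≡ 0ℚ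
∑-zero {n} f f≗0 = trans (sum-cong-≗ f≗0) (sum-replicate-zero n)

⌊suc≟suc⌋ : ∀ {n} (u k : Fin n) → ⌊ suc u ≟ suc k ⌋ ≡ ⌊ u ≟ k ⌋
⌊suc≟suc⌋ u k = trans (isYes≗does (suc u ≟ suc k)) (sym (isYes≗does (u ≟ k)))

⌊≟⌋-refl : ∀ {n} (i : Fin n) → ⌊ i ≟ i ⌋ ≡ true
⌊≟⌋-refl i = trans (isYes≗does (i ≟ i)) (dec-true (i ≟ i) refl)

⌊≟⌋-≢ : ∀ {n} {i j : Fin n} → i ≢ j → ⌊ i ≟ j ⌋ ≡ false
⌊≟⌋-≢ {i = i} {j} i≢j = trans (isYes≗does (i ≟ j)) (dec-false (i ≟ j) i≢j)

∑-select : ∀ {n} (u : Fin n) (f : Fin n → ℚ) → ∑[ k < n ] (if ⌊ u ≟ k ⌋ then f k else 0ℚ) ≡ f u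
∑-select {suc n} zero    f = trans (cong (f zero +_) (sum-replicate-zero n)) (ℚ.+-identityʳ (f zero))
∑-select {suc n} (suc u) f = begin
  0ℚ + ∑[ k < n ] (if ⌊ suc u ≟ suc k ⌋ then f (suc k) else 0ℚ)
    ≡⟨ ℚ.+-identityˡ _ ⟩
  ∑[ k < n ] (if ⌊ suc u ≟ suc k ⌋ then f (suc k) else 0ℚ)
    ≡⟨ sum-cong-≗ (λ k → cong (if_then f (suc k) else 0ℚ) (⌊suc≟suc⌋ u k)) ⟩
  ∑[ k < n ] (if ⌊ u ≟ k ⌋ then f (suc k) else 0ℚ)
    ≡⟨ ∑-select u (f ∘ suc) ⟩
  f (suc u) ∎
  where open ≡-Reasoning

∑-if-const : ∀ {n} (p : Fin n → Bool) c → ∑[ k < n ] (if p k then c else 0ℚ) ≡ ℕtoℚ (countℕ n p) * c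
∑-if-const {zero}  p c = sym (ℚ.*-zeroˡ c)
∑-if-const {suc n} p c with p zero
... | true  = begin
  c + ∑[ k < n ] (if p (suc k) then c else 0ℚ)  ≡⟨ cong (c +_) (∑-if-const (p ∘ suc) c) ⟩
  c + ℕtoℚ m * c                              ≡⟨ factor c (ℕtoℚ m) ⟩
  (1ℚ + ℕtoℚ m) * c                           ≡⟨ cong (_* c) (ℕtoℚ-+ 1 m) ⟨
  ℕtoℚ (1 ℕ.+ m) * c                          ∎
  where
  open ≡-Reasoning
  m : ℕ
  m = countℕ n (p ∘ suc)
  factor : ∀ c a → c + a * c ≡ (1ℚ + a) * c
  factor = solve-∀ ℚ-ring
... | false = trans (ℚ.+-identityˡ _) (∑-if-const (p ∘ suc) c)

∑-mono-≤ : ∀ {n} {f g : Fin n → ℚ} → (∀ i → f i ≤ g i) → sum f ≤ sum g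
∑-mono-≤ {zero}  f≤g = ≤-refl
∑-mono-≤ {suc n} f≤g = +-mono-≤ (f≤g zero) (∑-mono-≤ (f≤g ∘ suc))

∑-nonNeg : ∀ {n} {f : Fin n → ℚ} → (∀ i → 0ℚ ≤ f i) → 0ℚ ≤ sum f
∑-nonNeg {n} {f} 0≤f = subst (_≤ sum f) (sum-replicate-zero n) (∑-mono-≤ 0≤f)

≤-∑ : ∀ {n} (f : Fin n → ℚ) → (∀ i → 0ℚ ≤ f i) → ∀ k → f k ≤ sum f
≤-∑ {suc n} f 0≤f k = begin
  f k                        ≡⟨ ℚ.+-identityʳ (f k) ⟨
  f k + 0ℚ                   ≤⟨ +-monoʳ-≤ (f k) (∑-nonNeg (0≤f ∘ punchIn k)) ⟩
  f k + sum (f ∘ punchIn k)  ≡⟨ sum-remove f ⟨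
  sum f                      ∎
  where open ℚ.≤-Reasoning

if-then-0-* : ∀ b p c → (if b then p else 0ℚ) * c ≡ (if b then p * c else 0ℚ)
if-then-0-* true  p c = refl
if-then-0-* false p c = ℚ.*-zeroˡ c

*-if-then-1-0 : ∀ b c → c * (if b then 1ℚ else 0ℚ) ≡ (if b then c else 0ℚ)
*-if-then-1-0 true  c = ℚ.*-identityʳ c
*-if-then-1-0 false c = ℚ.*-zeroʳ c

module _ {n : ℕ} where

  infix 7 _·_
  _·_ : (Fin n → ℚ) → (Fin n → ℚ) → ℚ
  x · y = ∑[ i < n ] (x i * y i)

  infixr 8 _*ᵥ_
  _*ᵥ_ : Matrix n → (Fin n → ℚ) → Fin n → ℚ
  (M *ᵥ x) i = M i · x

  IsSymmetric : Matrix n → Set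
  IsSymmetric M = ∀ i j → M i j ≡ M j i

  IsPositiveSemidefinite : Matrix n → Set
  IsPositiveSemidefinite M = ∀ x → 0ℚ ≤ x · (M *ᵥ x)

  ⊗-entry : ∀ (M N : Matrix n) i j → (M ⊗ N) i j ≡ ∑[ k < n ] (M i k * N k j)
  ⊗-entry M N i j = Σℚ≡sum n (λ k → M i k * N k j)

  ·-comm : ∀ x y → x · y ≡ y · x
  ·-comm x y = sum-cong-≗ (λ i → ℚ.*-comm (x i) (y i))

  ·-congʳ : ∀ x {y z} → (∀ i → y i ≡ z i) → x · y ≡ x · z
  ·-congʳ x y≗z = sum-cong-≗ (λ i → cong (x i *_) (y≗z i))

  ·-zeroʳ : ∀ x {z} → (∀ i → z i ≡ 0ℚ) → x · z ≡ 0ℚ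
  ·-zeroʳ x {z} z≗0 = ∑-zero (λ i → x i * z i) (λ i → trans (cong (x i *_) (z≗0 i)) (ℚ.*-zeroʳ (x i)))

  [x-y]·z≡x·z-y·z : ∀ x y z → (λ i → x i - y i) · z ≡ x · z - y · z
  [x-y]·z≡x·z-y·z x y z = trans (sum-cong-≗ (λ i → [y-z]x≈yx-zx (z i) (x i) (y i)))
                                (∑-distrib-- (λ i → x i * z i) (λ i → y i * z i))

  x·[y-z]≡x·y-x·z : ∀ x y z → x · (λ i → y i - z i) ≡ x · y - x · z
  x·[y-z]≡x·y-x·z x y z = trans (sum-cong-≗ (λ i → x[y-z]≈xy-xz (x i) (y i) (z i)))
                                (∑-distrib-- (λ i → x i * y i) (λ i → x i * z i))

  ·-*ˡ : ∀ t x y → (λ i → t * x i) · y ≡ t * (x · y)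
  ·-*ˡ t x y = trans (sum-cong-≗ (λ i → ℚ.*-assoc t (x i) (y i))) (sym (*-distribˡ-sum t (λ i → x i * y i)))

  ·-*ʳ : ∀ t x y → x · (λ i → t * y i) ≡ t * (x · y)
  ·-*ʳ t x y = trans (·-comm x (λ i → t * y i)) (trans (·-*ˡ t y x) (cong (t *_) (·-comm y x)))

  *ᵥ-congˡ : ∀ {M N} → (∀ i j → M i j ≡ N i j) → ∀ x i → (M *ᵥ x) i ≡ (N *ᵥ x) i
  *ᵥ-congˡ M≗N x i = sum-cong-≗ (λ k → cong (_* x k) (M≗N i k))

  *ᵥ-zeroʳ : ∀ M {x} → (∀ k → x k ≡ 0ℚ) → ∀ i → (M *ᵥ x) i ≡ 0ℚ
  *ᵥ-zeroʳ M x≗0 i = ·-zeroʳ (M i) x≗0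

  quadForm-as-· : ∀ M x → quadForm M x ≡ x · (M *ᵥ x)
  quadForm-as-· M x = trans (Σℚ≡sum n (λ i → Σℚ n (λ j → x i * M i j * x j))) (sum-cong-≗ row)
    where
    row : ∀ i → Σℚ n (λ j → x i * M i j * x j) ≡ x i * (M *ᵥ x) i
    row i = trans (Σℚ≡sum n (λ j → x i * M i j * x j))
                  (trans (sum-cong-≗ (λ j → ℚ.*-assoc (x i) (M i j) (x j)))
                         (sym (*-distribˡ-sum (x i) (λ j → M i j * x j))))

  *ᵥ-⊗ : ∀ M N x i → ((M ⊗ N) *ᵥ x) i ≡ (M *ᵥ (N *ᵥ x)) i
  *ᵥ-⊗ M N x i = begin
    ∑[ j < n ] ((M ⊗ N) i j * x j)
      ≡⟨ sum-cong-≗ (λ j → trans (cong (_* x j) (⊗-entry M N i j))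
                                 (*-distribʳ-sum (x j) (λ k → M i k * N k j))) ⟩
    ∑[ j < n ] ∑[ k < n ] (M i k * N k j * x j)
      ≡⟨ ∑-comm (λ j k → M i k * N k j * x j) ⟩
    ∑[ k < n ] ∑[ j < n ] (M i k * N k j * x j)
      ≡⟨ sum-cong-≗ (λ k → trans (sum-cong-≗ (λ j → ℚ.*-assoc (M i k) (N k j) (x j)))
                                 (sym (*-distribˡ-sum (M i k) (λ j → N k j * x j)))) ⟩
    ∑[ k < n ] (M i k * (N *ᵥ x) k) ∎
    where open ≡-Reasoning

  *ᵥ-transpose : ∀ M x y → (M *ᵥ x) · y ≡ x · (transpose M *ᵥ y)
  *ᵥ-transpose M x y = begin
    ∑[ i < n ] ((M *ᵥ x) i * y i)
      ≡⟨ sum-cong-≗ (λ i → *-distribʳ-sum (y i) (λ k → M i k * x k)) ⟩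
    ∑[ i < n ] ∑[ k < n ] (M i k * x k * y i)
      ≡⟨ ∑-comm (λ i k → M i k * x k * y i) ⟩
    ∑[ k < n ] ∑[ i < n ] (M i k * x k * y i)
      ≡⟨ sum-cong-≗ (λ k → trans (sum-cong-≗ (λ i → rearrange (M i k) (x k) (y i)))
                                 (sym (*-distribˡ-sum (x k) (λ i → M i k * y i)))) ⟩
    ∑[ k < n ] (x k * (transpose M *ᵥ y) k) ∎
    where
    open ≡-Reasoning
    rearrange : ∀ m a b → m * a * b ≡ a * (m * b)
    rearrange = solve-∀ ℚ-ring

  form-sym : ∀ {M} → IsSymmetric M → ∀ x y → x · (M *ᵥ y) ≡ y · (M *ᵥ x)
  form-sym {M} M-sym x y = begin
    x · (M *ᵥ y)              ≡⟨ ·-comm x (M *ᵥ y) ⟩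
    (M *ᵥ y) · x              ≡⟨ *ᵥ-transpose M y x ⟩
    y · (transpose M *ᵥ x)    ≡⟨ ·-congʳ y (*ᵥ-congˡ (λ i j → M-sym j i) x) ⟩
    y · (M *ᵥ x)              ∎
    where open ≡-Reasoning

  *ᵥ-linear : ∀ M x y t i → (M *ᵥ (λ k → y k - t * x k)) i ≡ (M *ᵥ y) i - t * (M *ᵥ x) i
  *ᵥ-linear M x y t i =
    trans (x·[y-z]≡x·y-x·z (M i) y (λ k → t * x k)) (cong (λ w → (M *ᵥ y) i - w) (·-*ʳ t (M i) x))

  quadratic-expansion : ∀ {M} → IsSymmetric M → ∀ x y t → let z = λ k → y k - t * x k in
    z · (M *ᵥ z) ≡ (y · (M *ᵥ y) - t * (x · (M *ᵥ y))) - t * (x · (M *ᵥ y) - t * (x · (M *ᵥ x)))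
  quadratic-expansion {M} M-sym x y t = begin
    z · (M *ᵥ z)                          ≡⟨ ·-congʳ z (*ᵥ-linear M x y t) ⟩
    z · (λ i → My i - t * Mx i)           ≡⟨ x·[y-z]≡x·y-x·z z My (λ i → t * Mx i) ⟩
    z · My - z · (λ i → t * Mx i)         ≡⟨ cong (λ w → z · My - w) (·-*ʳ t z Mx) ⟩
    z · My - t * (z · Mx)                 ≡⟨ cong₂ (λ a b → a - t * b) (expand My) (expand Mx) ⟩
    (y · My - t * (x · My)) - t * (y · Mx - t * (x · Mx))
      ≡⟨ cong (λ w → (y · My - t * (x · My)) - t * (w - t * (x · Mx))) (form-sym M-sym y x) ⟩
    (y · My - t * (x · My)) - t * (x · My - t * (x · Mx)) ∎
    where
    open ≡-Reasoning
    z My Mx : Fin n → ℚ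
    z k = y k - t * x k
    My = M *ᵥ y
    Mx = M *ᵥ x
    expand : ∀ w → z · w ≡ y · w - t * (x · w)
    expand w = trans ([x-y]·z≡x·z-y·z y (λ k → t * x k) w) (cong (λ v → y · w - v) (·-*ˡ t x w))

  psd-bound : ∀ {M} → IsSymmetric M → IsPositiveSemidefinite M → ∀ x y t →
    t * (x · (M *ᵥ y)) + t * (x · (M *ᵥ y)) - t * t * (x · (M *ᵥ x)) ≤ y · (M *ᵥ y)
  psd-bound {M} M-sym M-psd x y t = 0≤q-p⇒p≤q (subst (0ℚ ≤_) expansion (M-psd (λ k → y k - t * x k)))
    where
    regroup : ∀ s p q t → (s - t * p) - t * (p - t * q) ≡ s - (t * p + t * p - t * t * q)
    regroup = solve-∀ ℚ-ring
    expansion : let z = λ k → y k - t * x k in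
      z · (M *ᵥ z) ≡ y · (M *ᵥ y) - (t * (x · (M *ᵥ y)) + t * (x · (M *ᵥ y)) - t * t * (x · (M *ᵥ x)))
    expansion = trans (quadratic-expansion M-sym x y t) (regroup (y · (M *ᵥ y)) (x · (M *ᵥ y)) (x · (M *ᵥ x)) t)

·-indicator : ∀ {n} (z : Fin n → ℚ) u → z · indicator u ≡ z u
·-indicator z u = trans (sum-cong-≗ (λ k → *-if-then-1-0 ⌊ u ≟ k ⌋ (z k))) (∑-select u z)

indicator-self : ∀ {n} (u : Fin n) → indicator u u ≡ 1ℚ
indicator-self u = cong (if_then 1ℚ else 0ℚ) (⌊≟⌋-refl u)

indicator-≢ : ∀ {n} {u v : Fin n} → u ≢ v → indicator u v ≡ 0ℚ
indicator-≢ u≢v = cong (if_then 1ℚ else 0ℚ) (⌊≟⌋-≢ u≢v)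

dipole : ∀ {n} → Fin n → Fin n → Fin n → ℚ
dipole u v k = indicator u k - indicator v k

dipole-drop : ∀ {n} {u v : Fin n} → u ≢ v → dipole u v u - dipole u v v ≡ 2ℚ
dipole-drop {u = u} {v} u≢v
  rewrite indicator-self u | indicator-self v | indicator-≢ u≢v | indicator-≢ (u≢v ∘ sym) = refl

·-dipole : ∀ {n} (z : Fin n → ℚ) u v → z · dipole u v ≡ z u - z v
·-dipole z u v = trans (x·[y-z]≡x·y-x·z z (indicator u) (indicator v)) (cong₂ _-_ (·-indicator z u) (·-indicator z v))

module Pseudoinverse {n} {M X : Matrix n} (M-sym : IsSymmetric M) (pinv : IsPseudoinverse M X) where
  open IsPseudoinverse pinv
  open ≡-Reasoning

  M⊗[M⊗X]≡M : ∀ i j → (M ⊗ (M ⊗ X)) i j ≡ M i j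
  M⊗[M⊗X]≡M i j = begin
    (M ⊗ (M ⊗ X)) i j                 ≡⟨ ⊗-entry M (M ⊗ X) i j ⟩
    ∑[ k < n ] (M i k * (M ⊗ X) k j)  ≡⟨ sum-cong-≗ (λ k → trans (cong₂ _*_ (M-sym i k) (sym (p3 k j)))
                                                               (ℚ.*-comm (M k i) ((M ⊗ X) j k))) ⟩
    ∑[ k < n ] ((M ⊗ X) j k * M k i)  ≡⟨ ⊗-entry (M ⊗ X) M j i ⟨
    ((M ⊗ X) ⊗ M) j i                 ≡⟨ p1 j i ⟩
    M j i                             ≡⟨ M-sym j i ⟩
    M i j                             ∎

  Xᵀ⊗[X⊗M]≡Xᵀ : ∀ k i → (transpose X ⊗ (X ⊗ M)) k i ≡ X i k
  Xᵀ⊗[X⊗M]≡Xᵀ k i = begin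
    (transpose X ⊗ (X ⊗ M)) k i       ≡⟨ ⊗-entry (transpose X) (X ⊗ M) k i ⟩
    ∑[ j < n ] (X j k * (X ⊗ M) j i)  ≡⟨ sum-cong-≗ (λ j → trans (cong (X j k *_) (p4 i j))
                                                               (ℚ.*-comm (X j k) ((X ⊗ M) i j))) ⟩
    ∑[ j < n ] ((X ⊗ M) i j * X j k)  ≡⟨ ⊗-entry (X ⊗ M) X i k ⟨
    ((X ⊗ M) ⊗ X) i k                 ≡⟨ p2 i k ⟩
    X i k                             ∎

  residual : (Fin n → ℚ) → Fin n → ℚ
  residual b i = b i - (M *ᵥ (X *ᵥ b)) i

  residual-∈-kernel : ∀ b i → (M *ᵥ residual b) i ≡ 0ℚ
  residual-∈-kernel b i = begin
    (M *ᵥ residual b) i                          ≡⟨ x·[y-z]≡x·y-x·z (M i) b (M *ᵥ (X *ᵥ b)) ⟩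
    (M *ᵥ b) i - (M *ᵥ (M *ᵥ (X *ᵥ b))) i        ≡⟨ cong (λ w → (M *ᵥ b) i - w) MMXb≡Mb ⟩
    (M *ᵥ b) i - (M *ᵥ b) i                      ≡⟨ ℚ.+-inverseʳ ((M *ᵥ b) i) ⟩
    0ℚ                                           ∎
    where
    MMXb≡Mb : (M *ᵥ (M *ᵥ (X *ᵥ b))) i ≡ (M *ᵥ b) i
    MMXb≡Mb = begin
      (M *ᵥ (M *ᵥ (X *ᵥ b))) i      ≡⟨ ·-congʳ (M i) (λ k → *ᵥ-⊗ M X b k) ⟨
      (M *ᵥ ((M ⊗ X) *ᵥ b)) i       ≡⟨ *ᵥ-⊗ M (M ⊗ X) b i ⟨
      ((M ⊗ (M ⊗ X)) *ᵥ b) i        ≡⟨ *ᵥ-congˡ M⊗[M⊗X]≡M b i ⟩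
      (M *ᵥ b) i                    ∎

  kernel⊆kernel-Xᵀ : ∀ e → (∀ i → (M *ᵥ e) i ≡ 0ℚ) → ∀ k → (transpose X *ᵥ e) k ≡ 0ℚ
  kernel⊆kernel-Xᵀ e Me≗0 k = begin
    (transpose X *ᵥ e) k                      ≡⟨ *ᵥ-congˡ Xᵀ⊗[X⊗M]≡Xᵀ e k ⟨
    ((transpose X ⊗ (X ⊗ M)) *ᵥ e) k          ≡⟨ *ᵥ-⊗ (transpose X) (X ⊗ M) e k ⟩
    (transpose X *ᵥ ((X ⊗ M) *ᵥ e)) k         ≡⟨ ·-congʳ (transpose X k) (λ j → *ᵥ-⊗ X M e j) ⟩
    (transpose X *ᵥ (X *ᵥ (M *ᵥ e))) k        ≡⟨ *ᵥ-zeroʳ (transpose X) (*ᵥ-zeroʳ X Me≗0) k ⟩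
    0ℚ                                        ∎

  M*ᵥX*ᵥb≡b-residual : ∀ b i → (M *ᵥ (X *ᵥ b)) i ≡ b i - residual b i
  M*ᵥX*ᵥb≡b-residual b i = sym (cancel (b i) ((M *ᵥ (X *ᵥ b)) i))
    where
    cancel : ∀ a p → a - (a - p) ≡ p
    cancel = solve-∀ ℚ-ring

  energy-of-X*ᵥ : ∀ b → (X *ᵥ b) · (M *ᵥ (X *ᵥ b)) ≡ b · (X *ᵥ b)
  energy-of-X*ᵥ b = begin
    y · (M *ᵥ y)                  ≡⟨ ·-congʳ y (M*ᵥX*ᵥb≡b-residual b) ⟩
    y · (λ i → b i - e i)         ≡⟨ x·[y-z]≡x·y-x·z y b e ⟩
    y · b - y · e                 ≡⟨ cong₂ _-_ (·-comm y b) (*ᵥ-transpose X b e) ⟩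
    b · y - b · (transpose X *ᵥ e)
      ≡⟨ cong (λ w → b · y - w) (·-zeroʳ b (kernel⊆kernel-Xᵀ e (residual-∈-kernel b))) ⟩
    b · y - 0ℚ                    ≡⟨ ℚ.+-identityʳ (b · y) ⟩
    b · y                         ∎
    where
    y e : Fin n → ℚ
    y = X *ᵥ b
    e = residual b

module Laplacian {n} (G : Graph n) where

  L A : Matrix n
  L = laplacian G
  A = adjMatrix G

  d : Fin n → ℚ
  d i = ℕtoℚ (deg G i)

  adj⇒≢ : ∀ {i j} → adj G i j ≡ true → i ≢ j
  adj⇒≢ {i} aᵢⱼ refl with trans (sym aᵢⱼ) (Graph.irrefl G i)
  ... | ()

  adjMatrix-sym : IsSymmetric A
  adjMatrix-sym i j = cong (if_then 1ℚ else 0ℚ) (Graph.sym G i j)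

  adjMatrix-nonNeg : ∀ i j → 0ℚ ≤ A i j
  adjMatrix-nonNeg i j with adj G i j
  ... | true  = ℚ.nonNegative⁻¹ 1ℚ
  ... | false = ≤-refl

  ∑-adjMatrix : ∀ i c → ∑[ j < n ] (A i j * c) ≡ d i * c
  ∑-adjMatrix i c = begin
    ∑[ j < n ] (A i j * c)                           ≡⟨ sum-cong-≗ (λ j → if-then-0-* (adj G i j) 1ℚ c) ⟩
    ∑[ j < n ] (if adj G i j then 1ℚ * c else 0ℚ)    ≡⟨ ∑-if-const (adj G i) (1ℚ * c) ⟩
    d i * (1ℚ * c)                                   ≡⟨ cong (d i *_) (ℚ.*-identityˡ c) ⟩
    d i * c                                          ∎
    where open ≡-Reasoning

  degMatrix-diag : ∀ i → degMatrix G i i ≡ d i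
  degMatrix-diag i = cong (if_then d i else 0ℚ) (⌊≟⌋-refl i)

  degMatrix-off : ∀ {i j} → i ≢ j → degMatrix G i j ≡ 0ℚ
  degMatrix-off {i} i≢j = cong (if_then d i else 0ℚ) (⌊≟⌋-≢ i≢j)

  ∑-degMatrix : ∀ x i → degMatrix G i · x ≡ d i * x i
  ∑-degMatrix x i = trans (sum-cong-≗ (λ j → if-then-0-* ⌊ i ≟ j ⌋ (d i) (x j))) (∑-select i (λ j → d i * x j))

  laplacian-sym : IsSymmetric L
  laplacian-sym i j = by-cases (i ≟ j)
    where
    by-cases : Dec (i ≡ j) → L i j ≡ L j i
    by-cases (yes i≡j) = cong₂ L i≡j (sym i≡j)
    by-cases (no i≢j)  = cong₂ _-_ (trans (degMatrix-off i≢j) (sym (degMatrix-off (i≢j ∘ sym)))) (adjMatrix-sym i j)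

  laplacian-diag : ∀ i → L i i ≡ d i
  laplacian-diag i = begin
    degMatrix G i i - A i i  ≡⟨ cong₂ _-_ (degMatrix-diag i) (cong (if_then 1ℚ else 0ℚ) (Graph.irrefl G i)) ⟩
    d i - 0ℚ                 ≡⟨ ℚ.+-identityʳ (d i) ⟩
    d i                      ∎
    where open ≡-Reasoning

  laplacian-adj : ∀ {i j} → adj G i j ≡ true → L i j ≡ - 1ℚ
  laplacian-adj aᵢⱼ = cong₂ _-_ (degMatrix-off (adj⇒≢ aᵢⱼ)) (cong (if_then 1ℚ else 0ℚ) aᵢⱼ)

  laplacian-*ᵥ : ∀ x i → (L *ᵥ x) i ≡ ∑[ j < n ] (A i j * (x i - x j))
  laplacian-*ᵥ x i = begin
    (L *ᵥ x) i                          ≡⟨ [x-y]·z≡x·z-y·z (degMatrix G i) (A i) x ⟩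
    degMatrix G i · x - A i · x         ≡⟨ cong (λ w → w - A i · x) (∑-degMatrix x i) ⟩
    d i * x i - A i · x                 ≡⟨ cong (λ w → w - A i · x) (∑-adjMatrix i (x i)) ⟨
    A i · (λ _ → x i) - A i · x         ≡⟨ x·[y-z]≡x·y-x·z (A i) (λ _ → x i) x ⟨
    A i · (λ j → x i - x j)             ∎
    where open ≡-Reasoning

  dirichlet : ∀ x → x · (L *ᵥ x) + x · (L *ᵥ x) ≡ ∑[ i < n ] ∑[ j < n ] (A i j * ((x i - x j) * (x i - x j)))
  dirichlet x = sym (begin
    ∑[ i < n ] ∑[ j < n ] (A i j * ((x i - x j) * (x i - x j)))
      ≡⟨ sum-cong-≗ (λ i → trans (sum-cong-≗ (λ j → split (A i j) (x i) (x j)))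
                                 (∑-distrib-- (λ j → F i j * x i) (λ j → F i j * x j))) ⟩
    ∑[ i < n ] (∑[ j < n ] (F i j * x i) - ∑[ j < n ] (F i j * x j))
      ≡⟨ ∑-distrib-- (λ i → ∑[ j < n ] (F i j * x i)) (λ i → ∑[ j < n ] (F i j * x j)) ⟩
    S - ∑[ i < n ] ∑[ j < n ] (F i j * x j)
      ≡⟨ cong (λ w → S - w) T≡-S ⟩
    S - - S
      ≡⟨ cong (S +_) (-‿involutive S) ⟩
    S + S
      ≡⟨ cong₂ _+_ S≡x·Lx S≡x·Lx ⟩
    x · (L *ᵥ x) + x · (L *ᵥ x) ∎)
    where
    open ≡-Reasoning
    F : Fin n → Fin n → ℚ
    F i j = A i j * (x i - x j)
    S : ℚ
    S = ∑[ i < n ] ∑[ j < n ] (F i j * x i)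
    split : ∀ a p q → a * ((p - q) * (p - q)) ≡ a * (p - q) * p - a * (p - q) * q
    split = solve-∀ ℚ-ring
    S≡x·Lx : S ≡ x · (L *ᵥ x)
    S≡x·Lx = sum-cong-≗ (λ i → begin
      ∑[ j < n ] (F i j * x i)  ≡⟨ *-distribʳ-sum (x i) (F i) ⟨
      ∑[ j < n ] (F i j) * x i  ≡⟨ cong (_* x i) (laplacian-*ᵥ x i) ⟨
      (L *ᵥ x) i * x i          ≡⟨ ℚ.*-comm ((L *ᵥ x) i) (x i) ⟩
      x i * (L *ᵥ x) i          ∎)
    antisym : ∀ a p q → a * (p - q) * q ≡ - (a * (q - p) * q)
    antisym = solve-∀ ℚ-ring
    T≡-S : ∑[ i < n ] ∑[ j < n ] (F i j * x j) ≡ - S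
    T≡-S = begin
      ∑[ i < n ] ∑[ j < n ] (F i j * x j)      ≡⟨ ∑-comm (λ i j → F i j * x j) ⟩
      ∑[ j < n ] ∑[ i < n ] (F i j * x j)      ≡⟨ sum-cong-≗ (λ j → sum-cong-≗ (λ i →
                                                    trans (cong (λ a → a * (x i - x j) * x j) (adjMatrix-sym i j))
                                                          (antisym (A j i) (x i) (x j)))) ⟩
      ∑[ j < n ] ∑[ i < n ] (- (F j i * x j))  ≡⟨ sum-cong-≗ (λ j → ∑-neg (λ i → F j i * x j)) ⟩
      ∑[ j < n ] (- ∑[ i < n ] (F j i * x j))  ≡⟨ ∑-neg (λ j → ∑[ i < n ] (F j i * x j)) ⟩
      - S                                      ∎

  laplacian-psd : IsPositiveSemidefinite L
  laplacian-psd x = 0≤p+p⇒0≤p (subst (0ℚ ≤_) (sym (dirichlet x))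
    (∑-nonNeg (λ i → ∑-nonNeg (λ j → *-nonNeg (adjMatrix-nonNeg i j) (square-nonNeg (x i - x j))))))

  edge-≤-dirichlet : ∀ {u v} → adj G u v ≡ true → ∀ x →
    (x u - x v) * (x u - x v) ≤ x · (L *ᵥ x) + x · (L *ᵥ x)
  edge-≤-dirichlet {u} {v} aᵤᵥ x = begin
    (x u - x v) * (x u - x v)                ≡⟨ ℚ.*-identityˡ _ ⟨
    1ℚ * ((x u - x v) * (x u - x v))         ≡⟨ cong (λ a → (if a then 1ℚ else 0ℚ) * ((x u - x v) * (x u - x v))) aᵤᵥ ⟨
    E u v                                    ≤⟨ ≤-∑ (E u) (E-nonNeg u) v ⟩
    ∑[ j < n ] E u j                         ≤⟨ ≤-∑ (λ i → ∑[ j < n ] E i j) (λ i → ∑-nonNeg (E-nonNeg i)) u ⟩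
    ∑[ i < n ] ∑[ j < n ] E i j              ≡⟨ dirichlet x ⟨
    x · (L *ᵥ x) + x · (L *ᵥ x)              ∎
    where
    open ℚ.≤-Reasoning
    E : Fin n → Fin n → ℚ
    E i j = A i j * ((x i - x j) * (x i - x j))
    E-nonNeg : ∀ i j → 0ℚ ≤ E i j
    E-nonNeg i j = *-nonNeg (adjMatrix-nonNeg i j) (square-nonNeg (x i - x j))

  kernel-constant-on-edges : ∀ x → (∀ i → (L *ᵥ x) i ≡ 0ℚ) → ∀ {u v} → adj G u v ≡ true → x u ≡ x v
  kernel-constant-on-edges x Lx≗0 aᵤᵥ = p-q≡0⇒p≡q (square≤0⇒≡0 _
    (subst (_ ≤_) (cong (λ w → w + w) (·-zeroʳ x Lx≗0)) (edge-≤-dirichlet aᵤᵥ x)))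

  dipole-energy : ∀ {u v} → adj G u v ≡ true → dipole u v · (L *ᵥ dipole u v) ≡ d u + d v + 2ℚ
  dipole-energy {u} {v} aᵤᵥ = begin
    b · (L *ᵥ b)                       ≡⟨ ·-comm b (L *ᵥ b) ⟩
    (L *ᵥ b) · b                       ≡⟨ ·-dipole (L *ᵥ b) u v ⟩
    (L *ᵥ b) u - (L *ᵥ b) v            ≡⟨ cong₂ _-_ (·-dipole (L u) u v) (·-dipole (L v) u v) ⟩
    (L u u - L u v) - (L v u - L v v)  ≡⟨ cong₂ (λ p q → (L u u - p) - (q - L v v)) (laplacian-adj aᵤᵥ) (laplacian-adj aᵥᵤ) ⟩
    (L u u - - 1ℚ) - (- 1ℚ - L v v)    ≡⟨ cong₂ (λ p q → (p - - 1ℚ) - (- 1ℚ - q)) (laplacian-diag u) (laplacian-diag v) ⟩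
    (d u - - 1ℚ) - (- 1ℚ - d v)        ≡⟨ regroup (d u) (d v) ⟩
    d u + d v + 2ℚ                     ∎
    where
    open ≡-Reasoning
    b : Fin n → ℚ
    b = dipole u v
    aᵥᵤ : adj G v u ≡ true
    aᵥᵤ = trans (Graph.sym G v u) aᵤᵥ
    regroup : ∀ p q → (p - - 1ℚ) - (- 1ℚ - q) ≡ p + q + (1ℚ + 1ℚ)
    regroup = solve-∀ ℚ-ring

module Resistance {n} (G : Graph n) {X : Matrix n} (pinv : IsPseudoinverse (laplacian G) X) where
  open Laplacian G
  open Pseudoinverse laplacian-sym pinv

  resistance-as-energy : ∀ u v → resistance X u v ≡ (X *ᵥ dipole u v) · (L *ᵥ (X *ᵥ dipole u v))
  resistance-as-energy u v = trans (quadForm-as-· X (dipole u v)) (sym (energy-of-X*ᵥ (dipole u v)))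

  dipole-current : ∀ {u v} → adj G u v ≡ true → dipole u v · (L *ᵥ (X *ᵥ dipole u v)) ≡ 2ℚ
  dipole-current {u} {v} aᵤᵥ = begin
    b · (L *ᵥ (X *ᵥ b))          ≡⟨ ·-congʳ b (M*ᵥX*ᵥb≡b-residual b) ⟩
    b · (λ i → b i - e i)        ≡⟨ x·[y-z]≡x·y-x·z b b e ⟩
    b · b - b · e                ≡⟨ cong₂ _-_ (·-dipole b u v) (trans (·-comm b e) (·-dipole e u v)) ⟩
    (b u - b v) - (e u - e v)    ≡⟨ cong₂ _-_ (dipole-drop (adj⇒≢ aᵤᵥ)) eᵤ-eᵥ≡0 ⟩
    2ℚ - 0ℚ                      ≡⟨⟩
    2ℚ                           ∎
    where
    open ≡-Reasoning
    b e : Fin n → ℚ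
    b = dipole u v
    e = residual b
    eᵤ-eᵥ≡0 : e u - e v ≡ 0ℚ
    eᵤ-eᵥ≡0 = trans (cong (_- e v) (kernel-constant-on-edges e (residual-∈-kernel b) aᵤᵥ)) (ℚ.+-inverseʳ (e v))

  resistance-lower-bound : ∀ {u v} → adj G u v ≡ true → ∀ t →
    t * 2ℚ + t * 2ℚ - t * t * (d u + d v + 2ℚ) ≤ resistance X u v
  resistance-lower-bound {u} {v} aᵤᵥ t = begin
    t * 2ℚ + t * 2ℚ - t * t * (d u + d v + 2ℚ)
      ≡⟨ cong₂ (λ p q → t * p + t * p - t * t * q) (dipole-current aᵤᵥ) (dipole-energy aᵤᵥ) ⟨
    t * (b · (L *ᵥ y)) + t * (b · (L *ᵥ y)) - t * t * (b · (L *ᵥ b))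
      ≤⟨ psd-bound laplacian-sym laplacian-psd b y t ⟩
    y · (L *ᵥ y)
      ≡⟨ resistance-as-energy u v ⟨
    resistance X u v ∎
    where
    open ℚ.≤-Reasoning
    b y : Fin n → ℚ
    b = dipole u v
    y = X *ᵥ b

  neighbour-resistance-≥ : ∀ {u v} → adj G v u ≡ true → deg G u ℕ.+ 2 ℕ.≤ deg G v →
    ∀ t → t * d v ≡ 1ℚ → t + t ≤ resistance X u v
  neighbour-resistance-≥ {u} {v} aᵥᵤ degᵤ+2≤degᵥ t td≡1 =
    4t-t²q≤r⇒2t≤r t (d v) td≡1 degree-bound (resistance-lower-bound (trans (Graph.sym G u v) aᵥᵤ) t)
    where
    open ℚ.≤-Reasoning
    regroup : ∀ p q → p + q + 2ℚ ≡ p + 2ℚ + q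
    regroup = solve-∀ ℚ-ring
    degree-bound : d u + d v + 2ℚ ≤ d v + d v
    degree-bound = begin
      d u + d v + 2ℚ              ≡⟨ regroup (d u) (d v) ⟩
      d u + 2ℚ + d v              ≡⟨ cong (_+ d v) (ℕtoℚ-+ (deg G u) 2) ⟨
      ℕtoℚ (deg G u ℕ.+ 2) + d v  ≤⟨ ℚ.+-monoˡ-≤ (d v) (ℕtoℚ-mono-≤ degᵤ+2≤degᵥ) ⟩
      d v + d v                   ∎

  neighbour-resistance-sum-≥ : ∀ v → 2 ℕ.≤ deg G v → (∀ u → adj G v u ≡ true → deg G u ℕ.+ 2 ℕ.≤ deg G v) →
    2ℚ ≤ ∑[ u < n ] (if adj G v u then resistance X u v else 0ℚ)
  neighbour-resistance-sum-≥ v 2≤degᵥ hdeg = begin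
    2ℚ                                                       ≡⟨ d[t+t]≡2 ⟨
    d v * (t + t)                                            ≡⟨ ∑-if-const (adj G v) (t + t) ⟨
    ∑[ u < n ] (if adj G v u then t + t else 0ℚ)             ≤⟨ ∑-mono-≤ termwise ⟩
    ∑[ u < n ] (if adj G v u then resistance X u v else 0ℚ) ∎
    where
    open ℚ.≤-Reasoning
    instance
      dᵥ≢0 : NonZero (d v)
      dᵥ≢0 = ℕtoℚ-nonZero (deg G v) {{ℕ.>-nonZero (ℕ.≤-trans (ℕ.s≤s ℕ.z≤n) 2≤degᵥ)}}
    t : ℚ
    t = 1/ d v
    td≡1 : t * d v ≡ 1ℚ
    td≡1 = ℚ.*-inverseˡ (d v)
    d[t+t]≡2 : d v * (t + t) ≡ 2ℚ
    d[t+t]≡2 = trans (ℚ.*-distribˡ-+ (d v) t t) (cong₂ _+_ dt≡1 dt≡1)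
      where
      dt≡1 : d v * t ≡ 1ℚ
      dt≡1 = ℚ.*-inverseʳ (d v)
    termwise : ∀ u → (if adj G v u then t + t else 0ℚ) ≤ (if adj G v u then resistance X u v else 0ℚ)
    termwise u with adj G v u in aᵥᵤ
    ... | true  = neighbour-resistance-≥ aᵥᵤ (hdeg u aᵥᵤ) t td≡1
    ... | false = ≤-refl

corollary1p15 : (n : ℕ) (G : Graph n) (Lp : Matrix n) →
    IsPseudoinverse (laplacian G) Lp →
    (v : Fin n) →
    2 ℕ.≤ deg G v →
    (∀ u → adj G v u ≡ true → deg G u ℕ.+ 2 ℕ.≤ deg G v) →
    curvature G Lp v ≤ 0ℚ
corollary1p15 n G Lp pinv v 2≤degᵥ hdeg = begin
  curvature G Lp v   ≡⟨ cong (λ s → 1ℚ - ½ * s) (Σℚ≡sum n r) ⟩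
  1ℚ - ½ * sum r     ≤⟨ +-monoʳ-≤ 1ℚ (neg-antimono-≤ (ℚ.*-monoˡ-≤-nonNeg ½ 2≤∑r)) ⟩
  1ℚ - ½ * 2ℚ        ≡⟨⟩
  0ℚ                 ∎
  where
  open ℚ.≤-Reasoning
  r : Fin n → ℚ
  r u = if adj G v u then resistance Lp u v else 0ℚ
  2≤∑r : 2ℚ ≤ sum r
  2≤∑r = Resistance.neighbour-resistance-sum-≥ G pinv v 2≤degᵥ hdeg
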